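{- If $G$ is a connected graph of order $n(G)$ and maximum degree $\Delta(G)$, then $$\chi_\mu(G)\le \left\lceil\frac{n(G)-\Delta(G)+2}{2}\right\rceil.$$
   Context: For a connected graph $G$ and $S\subseteq V(G)$, two vertices $x,y\in S$ are $S$-visible if there is a shortest $x,y$-path $P$ in $G$ with $V(P)\cap S=\{x,y\}$. $S$ is a mutual-visibility set if any two vertices of $S$ are $S$-visible. A mutual-visibility coloring of $G$ is a partition of $V(G)$ into mutual-visibility sets, and the mutual-visibility chromatic number $\chi_\mu(G)$ is the smallest number of classes in such a partition. -}

module Defs where

open import Data.Nat using (ℕ; zero; suc; _+_; _∸_; _≤_; _<_; _⊔_; ⌈_/2⌉)
open import Data.Fin using (Fin)
open import Data.Bool using (Bool; true; false; if_then_else_)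
open import Data.List using (List; []; _∷_; map; foldr; allFin)
open import Data.Nat.ListAction using (sum)
open import Data.List.Membership.Propositional using (_∈_)
open import Data.Product using (Σ; ∃; ∃-syntax; _×_; _,_)
open import Data.Sum using (_⊎_)
open import Relation.Nullary using (¬_)
open import Relation.Binary.PropositionalEquality using (_≡_)

record Graph (n : ℕ) : Set where
  field
    adj    : Fin n → Fin n → Bool
    sym    : ∀ x y → adj x y ≡ adj y x
    irrefl : ∀ x → adj x x ≡ false
open Graph public

module _ {n : ℕ} (G : Graph n) where

  data Walk : Fin n → Fin n → ℕ → Set where
    nil  : (x : Fin n) → Walk x x 0
    cons : ∀ {y z k} (x : Fin n) → adj G x y ≡ true → Walk y z k → Walk x z (suc k)

  verts : ∀ {x y k} → Walk x y k → List (Fin n)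
  verts (nil x)      = x ∷ []
  verts (cons x _ w) = x ∷ verts w

  Connected : Set
  Connected = ∀ x y → ∃[ k ] Walk x y k

  IsShortest : ∀ {x y k} → Walk x y k → Set
  IsShortest {x} {y} {k} _ = ∀ m → Walk x y m → k ≤ m

  Visible : (S : Fin n → Set) → Fin n → Fin n → Set
  Visible S x y = ∃[ k ] Σ (Walk x y k) λ P → IsShortest P ×
    (∀ v → v ∈ verts P → S v → (v ≡ x ⊎ v ≡ y))

  IsMutualVisibilitySet : (Fin n → Set) → Set
  IsMutualVisibilitySet S = ∀ x y → S x → S y → Visible S x y

  IsMVColoring : (k : ℕ) → (Fin n → Fin k) → Set
  IsMVColoring k col = ∀ i → IsMutualVisibilitySet (λ v → col v ≡ i)

  MVColorable : ℕ → Set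
  MVColorable k = Σ (Fin n → Fin k) (IsMVColoring k)

  IsMVChromaticNumber : ℕ → Set
  IsMVChromaticNumber k = MVColorable k × (∀ m → m < k → ¬ MVColorable m)

  degree : Fin n → ℕ
  degree v = sum (map (λ w → if adj G v w then 1 else 0) (allFin n))

  maxDegree : ℕ
  maxDegree = foldr _⊔_ 0 (map degree (allFin n))

-- Let v be a vertex of maximum degree Δ. Its open neighbourhood N(v) is a
-- mutual-visibility set: two neighbours are adjacent or at distance 2 through
-- v ∉ N(v). The other n − Δ vertices are split into ⌈(n − Δ)/2⌉ pairs, and a
-- set of at most two vertices is a mutual-visibility set of a connected graph
-- (any shortest path between them has no third vertex of the set). This gives
-- a colouring with 1 + ⌈(n − Δ)/2⌉ = ⌈(n − Δ + 2)/2⌉ classes.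
module Submission where

open import Defs
open import Data.Nat using (ℕ; zero; suc; _+_; _∸_; _≤_; _<_; ⌊_/2⌋; ⌈_/2⌉; z≤n; s≤s; s≤s⁻¹)
open import Data.Nat.Properties
open import Data.Nat.ListAction using (sum)
open import Data.Fin using (Fin; toℕ; fromℕ<)
open import Data.Fin.Properties using (any?; toℕ-fromℕ<; toℕ-injective) renaming (_≟_ to _≟ᶠ_)
open import Data.Bool using (Bool; true; false; not; if_then_else_)
open import Data.Bool.Properties using () renaming (_≟_ to _≟ᵇ_)
open import Data.List using ([]; _∷_; map; tabulate; allFin)
open import Data.List.Properties using (map-tabulate)
open import Data.List.Membership.Propositional using (_∈_)
open import Data.List.Membership.Propositional.Properties using (foldr-selective; ∈-map⁻)
open import Data.List.Relation.Unary.Any using (here; there)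
open import Data.Product using (Σ; ∃-syntax; _×_; _,_; proj₂)
open import Data.Sum using (_⊎_; inj₁; inj₂)
open import Data.Empty using (⊥-elim)
open import Function using (_∘_; id)
open import Relation.Nullary using (¬_; Dec; yes; no)
open import Relation.Nullary.Decidable using (_×-dec_)
open import Relation.Binary.PropositionalEquality
  using (_≡_; _≢_; refl; trans; cong; module ≡-Reasoning)
  renaming (sym to ≡-sym)

least-witness-below : {P : ℕ → Set} → (∀ m → Dec (P m)) → ∀ b →
  (∀ j → j < b → ¬ P j) ⊎ ∃[ m ] P m × (∀ j → P j → m ≤ j)
least-witness-below P? zero = inj₁ (λ _ ())
least-witness-below {P} P? (suc b) with least-witness-below P? b
... | inj₂ least = inj₂ least
... | inj₁ none with P? b
...   | yes pb = inj₂ (b , pb , λ j pj → ≮⇒≥ (λ j<b → none j j<b pj))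
...   | no ¬pb = inj₁ below
  where
  below : ∀ j → j < suc b → ¬ P j
  below j j<1+b with m≤n⇒m<n∨m≡n (s≤s⁻¹ j<1+b)
  ... | inj₁ j<b = none j j<b
  ... | inj₂ refl = ¬pb

least-witness : {P : ℕ → Set} → (∀ m → Dec (P m)) →
  ∀ {k} → P k → ∃[ m ] P m × (∀ j → P j → m ≤ j)
least-witness P? {k} p with least-witness-below P? (suc k)
... | inj₁ none  = ⊥-elim (none k ≤-refl p)
... | inj₂ least = least

AtMostTwo : {A : Set} → (A → Set) → Set
AtMostTwo {A} S = ∀ (x y z : A) → S x → S y → S z → x ≡ y ⊎ x ≡ z ⊎ y ≡ z

AtMostTwo-preimage : {A B : Set} {S : A → Set} {T : B → Set} (r : A → B) →
  (∀ a b → S a → S b → r a ≡ r b → a ≡ b) →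
  AtMostTwo T → AtMostTwo (λ a → S a × T (r a))
AtMostTwo-preimage r r-inj two x y z (sx , tx) (sy , ty) (sz , tz)
  with two (r x) (r y) (r z) tx ty tz
... | inj₁ e        = inj₁ (r-inj x y sx sy e)
... | inj₂ (inj₁ e) = inj₂ (inj₁ (r-inj x z sx sz e))
... | inj₂ (inj₂ e) = inj₂ (inj₂ (r-inj y z sy sz e))

⌊/2⌋-fibre : ∀ {a h} → ⌊ a /2⌋ ≡ h → a ≡ h + h ⊎ a ≡ suc (h + h)
⌊/2⌋-fibre {zero}        refl = inj₁ refl
⌊/2⌋-fibre {suc zero}    refl = inj₂ refl
⌊/2⌋-fibre {suc (suc a)} refl with ⌊/2⌋-fibre {a} refl
... | inj₁ e = inj₁ (trans (cong (suc ∘ suc) e) (≡-sym (cong suc (+-suc h h))))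
  where h = ⌊ a /2⌋
... | inj₂ e = inj₂ (trans (cong (suc ∘ suc) e) (≡-sym (cong (suc ∘ suc) (+-suc h h))))
  where h = ⌊ a /2⌋

⌊/2⌋-AtMostTwo : ∀ h → AtMostTwo (λ a → ⌊ a /2⌋ ≡ h)
⌊/2⌋-AtMostTwo h a b c ha hb hc with ⌊/2⌋-fibre ha | ⌊/2⌋-fibre hb | ⌊/2⌋-fibre hc
... | inj₁ ea | inj₁ eb | _       = inj₁ (trans ea (≡-sym eb))
... | inj₂ ea | inj₂ eb | _       = inj₁ (trans ea (≡-sym eb))
... | inj₁ ea | inj₂ _  | inj₁ ec = inj₂ (inj₁ (trans ea (≡-sym ec)))
... | inj₂ ea | inj₁ _  | inj₂ ec = inj₂ (inj₁ (trans ea (≡-sym ec)))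
... | inj₁ _  | inj₂ eb | inj₂ ec = inj₂ (inj₂ (trans eb (≡-sym ec)))
... | inj₂ _  | inj₁ eb | inj₁ ec = inj₂ (inj₂ (trans eb (≡-sym ec)))

⌊/2⌋<⌈/2⌉ : ∀ {r m} → r < m → ⌊ r /2⌋ < ⌈ m /2⌉
⌊/2⌋<⌈/2⌉ r<m = ⌊n/2⌋-mono (s≤s r<m)

count : ∀ {n} → (Fin n → Bool) → ℕ
count {zero}  f = 0
count {suc n} f = (if f Fin.zero then 1 else 0) + count (f ∘ Fin.suc)

rank : ∀ {n} → (Fin n → Bool) → Fin n → ℕ
rank {suc n} f Fin.zero    = 0
rank {suc n} f (Fin.suc i) = (if f Fin.zero then 1 else 0) + rank (f ∘ Fin.suc) i

count-allFin : ∀ n (f : Fin n → Bool) →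
  sum (map (λ w → if f w then 1 else 0) (allFin n)) ≡ count f
count-allFin zero    f = refl
count-allFin (suc n) f = cong (g Fin.zero +_) (begin
  sum (map g (tabulate Fin.suc))       ≡⟨ cong sum (map-tabulate Fin.suc g) ⟩
  sum (tabulate (g ∘ Fin.suc))         ≡⟨ cong sum (≡-sym (map-tabulate id (g ∘ Fin.suc))) ⟩
  sum (map (g ∘ Fin.suc) (allFin n))   ≡⟨ count-allFin n (f ∘ Fin.suc) ⟩
  count (f ∘ Fin.suc)                  ∎)
  where
  open ≡-Reasoning
  g : Fin (suc n) → ℕ
  g w = if f w then 1 else 0

count-not+count : ∀ n (f : Fin n → Bool) → count (not ∘ f) + count f ≡ n
count-not+count zero    f = refl
count-not+count (suc n) f with f Fin.zero | count-not+count n (f ∘ Fin.suc)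
... | true  | ih = trans (+-suc _ _) (cong suc ih)
... | false | ih = cong suc ih

count-not : ∀ n (f : Fin n → Bool) → count (not ∘ f) ≡ n ∸ count f
count-not n f = begin
  count (not ∘ f)                     ≡⟨ ≡-sym (m+n∸n≡m (count (not ∘ f)) (count f)) ⟩
  count (not ∘ f) + count f ∸ count f ≡⟨ cong (_∸ count f) (count-not+count n f) ⟩
  n ∸ count f                         ∎
  where open ≡-Reasoning

rank<count : ∀ {n} (f : Fin n → Bool) u → f u ≡ true → rank f u < count f
rank<count {suc n} f Fin.zero    fu rewrite fu = s≤s z≤n
rank<count {suc n} f (Fin.suc i) fi =
  +-monoʳ-< (if f Fin.zero then 1 else 0) (rank<count (f ∘ Fin.suc) i fi)

rank-injective : ∀ {n} (f : Fin n → Bool) a b → f a ≡ true → f b ≡ true →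
  rank f a ≡ rank f b → a ≡ b
rank-injective {suc n} f Fin.zero    Fin.zero    fa fb r = refl
rank-injective {suc n} f Fin.zero    (Fin.suc b) fa fb r rewrite fa with r
... | ()
rank-injective {suc n} f (Fin.suc a) Fin.zero    fa fb r rewrite fb with r
... | ()
rank-injective {suc n} f (Fin.suc a) (Fin.suc b) fa fb r =
  cong Fin.suc (rank-injective (f ∘ Fin.suc) a b fa fb
    (+-cancelˡ-≡ (if f Fin.zero then 1 else 0) _ _ r))

module _ {n : ℕ} (G : Graph n) where

  degree≡count : ∀ v → degree G v ≡ count (adj G v)
  degree≡count v = count-allFin n (adj G v)

  maxDegree-attained : Fin n → ∃[ v ] maxDegree G ≤ degree G v
  maxDegree-attained u with foldr-selective ⊔-sel 0 (map (degree G) (allFin n))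
  ... | inj₁ Δ≡0 = u , ≤-trans (≤-reflexive Δ≡0) z≤n
  ... | inj₂ Δ∈degrees with ∈-map⁻ (degree G) Δ∈degrees
  ...   | v , _ , Δ≡deg = v , ≤-reflexive Δ≡deg

  walk? : ∀ m x y → Dec (Walk G x y m)
  walk? zero x y with x ≟ᶠ y
  ... | yes refl = yes (nil x)
  ... | no x≢y   = no λ { (nil _) → x≢y refl }
  walk? (suc m) x y with any? (λ z → (adj G x z ≟ᵇ true) ×-dec walk? m z y)
  ... | yes (z , xz , w) = yes (cons x xz w)
  ... | no ¬step         = no λ { (cons {y = z} _ xz w) → ¬step (z , xz , w) }

  shortestWalk : Connected G → ∀ x y → ∃[ k ] Σ (Walk G x y k) (IsShortest G)
  shortestWalk conn x y = least-witness (λ m → walk? m x y) (proj₂ (conn x y))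

  edge-isShortest : ∀ {x y} → x ≢ y → (xy : adj G x y ≡ true) →
    IsShortest G (cons x xy (nil y))
  edge-isShortest x≢y xy zero    (nil _) = ⊥-elim (x≢y refl)
  edge-isShortest x≢y xy (suc m) _       = s≤s z≤n

  twoStep-isShortest : ∀ {x v y} → x ≢ y → adj G x y ≡ false →
    (xv : adj G x v ≡ true) (vy : adj G v y ≡ true) →
    IsShortest G (cons x xv (cons v vy (nil y)))
  twoStep-isShortest x≢y ¬xy xv vy zero          (nil _)           = ⊥-elim (x≢y refl)
  twoStep-isShortest x≢y ¬xy xv vy (suc zero)    (cons _ xy (nil _)) with trans (≡-sym xy) ¬xy
  ... | ()
  twoStep-isShortest x≢y ¬xy xv vy (suc (suc m)) _                 = s≤s (s≤s z≤n)

  visible-refl : ∀ S x → Visible G S x x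
  visible-refl S x = 0 , nil x , (λ _ _ → z≤n) , λ { _ (here refl) _ → inj₁ refl }

  IsMutualVisibilitySet-⊆ : {S T : Fin n → Set} → (∀ v → T v → S v) →
    IsMutualVisibilitySet G S → IsMutualVisibilitySet G T
  IsMutualVisibilitySet-⊆ T⊆S mvS x y tx ty with mvS x y (T⊆S x tx) (T⊆S y ty)
  ... | k , P , shortest , inner = k , P , shortest , λ w w∈P tw → inner w w∈P (T⊆S w tw)

  neighbourhood-mutualVisibility : ∀ v → IsMutualVisibilitySet G (λ w → adj G v w ≡ true)
  neighbourhood-mutualVisibility v x y vx vy with x ≟ᶠ y
  ... | yes refl = visible-refl _ x
  ... | no x≢y with adj G x y in xy
  ...   | true  = 1 , cons x xy (nil y) , edge-isShortest x≢y xy , ends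
    where
    ends : ∀ w → w ∈ x ∷ y ∷ [] → adj G v w ≡ true → w ≡ x ⊎ w ≡ y
    ends w (here refl)         _ = inj₁ refl
    ends w (there (here refl)) _ = inj₂ refl
  ...   | false = 2 , cons x xv (cons v vy (nil y)) , twoStep-isShortest x≢y xy xv vy , ends
    where
    xv : adj G x v ≡ true
    xv = trans (sym G x v) vx
    ends : ∀ w → w ∈ x ∷ v ∷ y ∷ [] → adj G v w ≡ true → w ≡ x ⊎ w ≡ y
    ends w (here refl)                 _  = inj₁ refl
    ends w (there (here refl))         vv with trans (≡-sym vv) (irrefl G v)
    ... | ()
    ends w (there (there (here refl))) _  = inj₂ refl

  AtMostTwo-mutualVisibility : Connected G → {S : Fin n → Set} →
    AtMostTwo S → IsMutualVisibilitySet G S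
  AtMostTwo-mutualVisibility conn {S} two x y sx sy with x ≟ᶠ y
  ... | yes refl = visible-refl S x
  ... | no x≢y with shortestWalk conn x y
  ...   | k , P , shortest = k , P , shortest , ends
    where
    ends : ∀ w → w ∈ verts G P → S w → w ≡ x ⊎ w ≡ y
    ends w _ sw with two x y w sx sy sw
    ... | inj₁ x≡y        = ⊥-elim (x≢y x≡y)
    ... | inj₂ (inj₁ x≡w) = inj₁ (≡-sym x≡w)
    ... | inj₂ (inj₂ y≡w) = inj₂ (≡-sym y≡w)

  mvColorable-fromℕ : ∀ {k} (c : Fin n → ℕ) → (∀ u → c u < k) →
    (∀ i → IsMutualVisibilitySet G (λ u → c u ≡ i)) → MVColorable G k
  mvColorable-fromℕ c c<k mv = colour , λ i →
    IsMutualVisibilitySet-⊆ (λ u cu≡i → trans (≡-sym (toℕ-fromℕ< (c<k u))) (cong toℕ cu≡i))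
      (mv (toℕ i))
    where
    colour : Fin n → Fin _
    colour u = fromℕ< (c<k u)

  module NeighbourhoodAndPairs (v : Fin n) where

    nonNeighbour : Fin n → Bool
    nonNeighbour = not ∘ adj G v

    colour : Fin n → ℕ
    colour u = if adj G v u then 0 else suc ⌊ rank nonNeighbour u /2⌋

    colour< : ∀ u → colour u < suc ⌈ count nonNeighbour /2⌉
    colour< u with adj G v u in vu
    ... | true  = s≤s z≤n
    ... | false = s≤s (⌊/2⌋<⌈/2⌉ (rank<count nonNeighbour u (cong not vu)))

    colour≡0 : ∀ u → colour u ≡ 0 → adj G v u ≡ true
    colour≡0 u with adj G v u
    ... | true = λ _ → refl

    colour≡suc : ∀ j u → colour u ≡ suc j →
      nonNeighbour u ≡ true × ⌊ rank nonNeighbour u /2⌋ ≡ j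
    colour≡suc j u with adj G v u
    ... | false = λ { refl → refl , refl }

    colour-classes : Connected G → ∀ i → IsMutualVisibilitySet G (λ u → colour u ≡ i)
    colour-classes conn zero    =
      IsMutualVisibilitySet-⊆ colour≡0 (neighbourhood-mutualVisibility v)
    colour-classes conn (suc j) =
      IsMutualVisibilitySet-⊆ (colour≡suc j)
        (AtMostTwo-mutualVisibility conn
          (AtMostTwo-preimage (rank nonNeighbour) (rank-injective nonNeighbour)
            (⌊/2⌋-AtMostTwo j)))

    count-nonNeighbour : maxDegree G ≤ degree G v →
      count nonNeighbour ≤ n ∸ maxDegree G
    count-nonNeighbour Δ≤deg = begin
      count nonNeighbour     ≡⟨ count-not n (adj G v) ⟩
      n ∸ count (adj G v)    ≡⟨ cong (n ∸_) (≡-sym (degree≡count v)) ⟩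
      n ∸ degree G v         ≤⟨ ∸-monoʳ-≤ n Δ≤deg ⟩
      n ∸ maxDegree G        ∎
      where open ≤-Reasoning

mvColorable : ∀ n (G : Graph n) → Connected G → MVColorable G ⌈ (n ∸ maxDegree G) + 2 /2⌉
mvColorable zero    G conn = (λ ()) , λ _ ()
mvColorable (suc m) G conn with maxDegree-attained G Fin.zero
... | v , Δ≤deg = mvColorable-fromℕ G colour colour<bound (colour-classes conn)
  where
  open NeighbourhoodAndPairs G v
  colour<bound : ∀ u → colour u < ⌈ (suc m ∸ maxDegree G) + 2 /2⌉
  colour<bound u = <-≤-trans (colour< u) (begin
    suc ⌈ count nonNeighbour /2⌉      ≤⟨ s≤s (⌈n/2⌉-mono (count-nonNeighbour Δ≤deg)) ⟩
    ⌈ 2 + (suc m ∸ maxDegree G) /2⌉   ≡⟨ cong ⌈_/2⌉ (+-comm 2 (suc m ∸ maxDegree G)) ⟩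
    ⌈ (suc m ∸ maxDegree G) + 2 /2⌉   ∎)
    where open ≤-Reasoning

corollary5p4 : (n : ℕ) (G : Graph n) → Connected G →
    (χ : ℕ) → IsMVChromaticNumber G χ →
    χ ≤ ⌈ (n ∸ maxDegree G) + 2 /2⌉
corollary5p4 n G conn χ (_ , minimal) =
  ≮⇒≥ (λ χ<bound → minimal _ χ<bound (mvColorable n G conn))
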